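{- For every integer $n\ge 7$, $$c_2(n,K_4^-)=\left\lfloor\frac{n}{3}\right\rfloor.$$
   Context: A $3$-graph $H=(V,E)$ consists of a finite vertex set $V$ and an edge set $E\subseteq\binom{V}{3}$. For distinct $a,b\in V$, the codegree $d_H(a,b)$ is the number of vertices $c$ with $\{a,b,c\}\in E$, and the minimum codegree $\delta_2(H)$ is the minimum of $d_H(a,b)$ over all pairs of distinct vertices. For $3$-graphs $F$ and $H$, an $F$-covering of $H$ is a collection of copies of $F$ in $H$ such that every vertex of $H$ lies in at least one of them (i.e. $H$ has an $F$-covering iff every vertex of $H$ is contained in some subgraph of $H$ isomorphic to $F$). Define $c_2(n,F)$ as the maximum of $\delta_2(H)$ over all $3$-graphs $H$ on $n$ vertices having no $F$-covering; equivalently, the maximum integer $t$ such that some $n$-vertex $3$-graph with minimum codegree $t$ has no $F$-covering. $K_4^-$ denotes the $3$-graph on $4$ vertices with $3$ edges (the complete $3$-graph on $4$ vertices with one edge removed). -}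

module Defs where

open import Data.Nat using (ℕ; suc; _≤_; _+_)
open import Data.Fin using (Fin; zero; suc; _≟_)
open import Data.Bool using (Bool; true; false; _∧_; _∨_; not; if_then_else_)
open import Data.List using (List; map; allFin)
open import Data.Nat.ListAction using (sum)
open import Data.Product using (Σ; _×_; ∃-syntax; proj₁)
open import Relation.Nullary using (¬_)
open import Relation.Nullary.Decidable using (⌊_⌋)
open import Relation.Binary.PropositionalEquality using (_≡_; refl)
open import Function.Definitions using (Injective)

-- The edge set E ⊆ (Fin n choose 3) is
-- encoded by its (symmetric) indicator function on ordered triples:
-- edge a b c = true  iff  {a,b,c} ∈ E.  Triples with a repeated vertex
-- are never edges, and the indicator is invariant under permutations,
-- so such records correspond exactly to subsets of (V choose 3).
record 3Graph (n : ℕ) : Set where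
  field
    edge      : Fin n → Fin n → Fin n → Bool
    edge-swap₁₂ : ∀ a b c → edge a b c ≡ edge b a c
    edge-swap₂₃ : ∀ a b c → edge a b c ≡ edge a c b
    edge-loop   : ∀ a c → edge a a c ≡ false
open 3Graph public

codeg : ∀ {n} → 3Graph n → Fin n → Fin n → ℕ
codeg {n} H a b = sum (map (λ c → if edge H a b c then 1 else 0) (allFin n))

MinCodegAtLeast : ∀ {n} → 3Graph n → ℕ → Set
MinCodegAtLeast {n} H t = ∀ (a b : Fin n) → ¬ (a ≡ b) → t ≤ codeg H a b

Copy : ∀ {k n} → 3Graph k → 3Graph n → Set
Copy {k} {n} F H =
  Σ (Fin k → Fin n) λ φ →
    Injective _≡_ _≡_ φ ×
    (∀ x y z → edge F x y z ≡ true → edge H (φ x) (φ y) (φ z) ≡ true)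

InCopy : ∀ {k n} → 3Graph k → 3Graph n → Fin n → Set
InCopy {k} F H v = Σ (Copy F H) λ c → ∃[ x ] (proj₁ c x ≡ v)

HasCovering : ∀ {k n} → 3Graph k → 3Graph n → Set
HasCovering {n = n} F H = ∀ (v : Fin n) → InCopy F H v

-- c₂(n,F) = t : t is the maximum of δ₂(H) over n-vertex 3-graphs H with no
-- F-covering.  (Some such H has δ₂(H) ≥ t, and no H with δ₂(H) ≥ t+1
-- lacks an F-covering; together this says the maximum equals t.)
C2≡ : ∀ {k} → ℕ → 3Graph k → ℕ → Set
C2≡ n F t =
  (Σ (3Graph n) λ H → MinCodegAtLeast H t × ¬ HasCovering F H) ×
  (∀ (H : 3Graph n) → MinCodegAtLeast H (suc t) → HasCovering F H)

-- K₄⁻ on Fin 4: all triples of distinct vertices except {1,2,3},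
-- i.e. the distinct triples containing vertex 0.
distinct3 : Fin 4 → Fin 4 → Fin 4 → Bool
distinct3 a b c = not ⌊ a ≟ b ⌋ ∧ not ⌊ b ≟ c ⌋ ∧ not ⌊ a ≟ c ⌋

isZero : Fin 4 → Bool
isZero zero = true
isZero (suc _) = false

k4e : Fin 4 → Fin 4 → Fin 4 → Bool
k4e a b c = distinct3 a b c ∧ (isZero a ∨ isZero b ∨ isZero c)

k4e-swap₁₂ : ∀ a b c → k4e a b c ≡ k4e b a c
k4e-swap₁₂ zero zero zero = refl
k4e-swap₁₂ zero zero (suc zero) = refl
k4e-swap₁₂ zero zero (suc (suc zero)) = refl
k4e-swap₁₂ zero zero (suc (suc (suc zero))) = refl
k4e-swap₁₂ zero (suc zero) zero = refl
k4e-swap₁₂ zero (suc zero) (suc zero) = refl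
k4e-swap₁₂ zero (suc zero) (suc (suc zero)) = refl
k4e-swap₁₂ zero (suc zero) (suc (suc (suc zero))) = refl
k4e-swap₁₂ zero (suc (suc zero)) zero = refl
k4e-swap₁₂ zero (suc (suc zero)) (suc zero) = refl
k4e-swap₁₂ zero (suc (suc zero)) (suc (suc zero)) = refl
k4e-swap₁₂ zero (suc (suc zero)) (suc (suc (suc zero))) = refl
k4e-swap₁₂ zero (suc (suc (suc zero))) zero = refl
k4e-swap₁₂ zero (suc (suc (suc zero))) (suc zero) = refl
k4e-swap₁₂ zero (suc (suc (suc zero))) (suc (suc zero)) = refl
k4e-swap₁₂ zero (suc (suc (suc zero))) (suc (suc (suc zero))) = refl
k4e-swap₁₂ (suc zero) zero zero = refl
k4e-swap₁₂ (suc zero) zero (suc zero) = refl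
k4e-swap₁₂ (suc zero) zero (suc (suc zero)) = refl
k4e-swap₁₂ (suc zero) zero (suc (suc (suc zero))) = refl
k4e-swap₁₂ (suc zero) (suc zero) zero = refl
k4e-swap₁₂ (suc zero) (suc zero) (suc zero) = refl
k4e-swap₁₂ (suc zero) (suc zero) (suc (suc zero)) = refl
k4e-swap₁₂ (suc zero) (suc zero) (suc (suc (suc zero))) = refl
k4e-swap₁₂ (suc zero) (suc (suc zero)) zero = refl
k4e-swap₁₂ (suc zero) (suc (suc zero)) (suc zero) = refl
k4e-swap₁₂ (suc zero) (suc (suc zero)) (suc (suc zero)) = refl
k4e-swap₁₂ (suc zero) (suc (suc zero)) (suc (suc (suc zero))) = refl
k4e-swap₁₂ (suc zero) (suc (suc (suc zero))) zero = refl
k4e-swap₁₂ (suc zero) (suc (suc (suc zero))) (suc zero) = refl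
k4e-swap₁₂ (suc zero) (suc (suc (suc zero))) (suc (suc zero)) = refl
k4e-swap₁₂ (suc zero) (suc (suc (suc zero))) (suc (suc (suc zero))) = refl
k4e-swap₁₂ (suc (suc zero)) zero zero = refl
k4e-swap₁₂ (suc (suc zero)) zero (suc zero) = refl
k4e-swap₁₂ (suc (suc zero)) zero (suc (suc zero)) = refl
k4e-swap₁₂ (suc (suc zero)) zero (suc (suc (suc zero))) = refl
k4e-swap₁₂ (suc (suc zero)) (suc zero) zero = refl
k4e-swap₁₂ (suc (suc zero)) (suc zero) (suc zero) = refl
k4e-swap₁₂ (suc (suc zero)) (suc zero) (suc (suc zero)) = refl
k4e-swap₁₂ (suc (suc zero)) (suc zero) (suc (suc (suc zero))) = refl
k4e-swap₁₂ (suc (suc zero)) (suc (suc zero)) zero = refl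
k4e-swap₁₂ (suc (suc zero)) (suc (suc zero)) (suc zero) = refl
k4e-swap₁₂ (suc (suc zero)) (suc (suc zero)) (suc (suc zero)) = refl
k4e-swap₁₂ (suc (suc zero)) (suc (suc zero)) (suc (suc (suc zero))) = refl
k4e-swap₁₂ (suc (suc zero)) (suc (suc (suc zero))) zero = refl
k4e-swap₁₂ (suc (suc zero)) (suc (suc (suc zero))) (suc zero) = refl
k4e-swap₁₂ (suc (suc zero)) (suc (suc (suc zero))) (suc (suc zero)) = refl
k4e-swap₁₂ (suc (suc zero)) (suc (suc (suc zero))) (suc (suc (suc zero))) = refl
k4e-swap₁₂ (suc (suc (suc zero))) zero zero = refl
k4e-swap₁₂ (suc (suc (suc zero))) zero (suc zero) = refl
k4e-swap₁₂ (suc (suc (suc zero))) zero (suc (suc zero)) = refl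
k4e-swap₁₂ (suc (suc (suc zero))) zero (suc (suc (suc zero))) = refl
k4e-swap₁₂ (suc (suc (suc zero))) (suc zero) zero = refl
k4e-swap₁₂ (suc (suc (suc zero))) (suc zero) (suc zero) = refl
k4e-swap₁₂ (suc (suc (suc zero))) (suc zero) (suc (suc zero)) = refl
k4e-swap₁₂ (suc (suc (suc zero))) (suc zero) (suc (suc (suc zero))) = refl
k4e-swap₁₂ (suc (suc (suc zero))) (suc (suc zero)) zero = refl
k4e-swap₁₂ (suc (suc (suc zero))) (suc (suc zero)) (suc zero) = refl
k4e-swap₁₂ (suc (suc (suc zero))) (suc (suc zero)) (suc (suc zero)) = refl
k4e-swap₁₂ (suc (suc (suc zero))) (suc (suc zero)) (suc (suc (suc zero))) = refl
k4e-swap₁₂ (suc (suc (suc zero))) (suc (suc (suc zero))) zero = refl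
k4e-swap₁₂ (suc (suc (suc zero))) (suc (suc (suc zero))) (suc zero) = refl
k4e-swap₁₂ (suc (suc (suc zero))) (suc (suc (suc zero))) (suc (suc zero)) = refl
k4e-swap₁₂ (suc (suc (suc zero))) (suc (suc (suc zero))) (suc (suc (suc zero))) = refl

k4e-swap₂₃ : ∀ a b c → k4e a b c ≡ k4e a c b
k4e-swap₂₃ zero zero zero = refl
k4e-swap₂₃ zero zero (suc zero) = refl
k4e-swap₂₃ zero zero (suc (suc zero)) = refl
k4e-swap₂₃ zero zero (suc (suc (suc zero))) = refl
k4e-swap₂₃ zero (suc zero) zero = refl
k4e-swap₂₃ zero (suc zero) (suc zero) = refl
k4e-swap₂₃ zero (suc zero) (suc (suc zero)) = refl
k4e-swap₂₃ zero (suc zero) (suc (suc (suc zero))) = refl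
k4e-swap₂₃ zero (suc (suc zero)) zero = refl
k4e-swap₂₃ zero (suc (suc zero)) (suc zero) = refl
k4e-swap₂₃ zero (suc (suc zero)) (suc (suc zero)) = refl
k4e-swap₂₃ zero (suc (suc zero)) (suc (suc (suc zero))) = refl
k4e-swap₂₃ zero (suc (suc (suc zero))) zero = refl
k4e-swap₂₃ zero (suc (suc (suc zero))) (suc zero) = refl
k4e-swap₂₃ zero (suc (suc (suc zero))) (suc (suc zero)) = refl
k4e-swap₂₃ zero (suc (suc (suc zero))) (suc (suc (suc zero))) = refl
k4e-swap₂₃ (suc zero) zero zero = refl
k4e-swap₂₃ (suc zero) zero (suc zero) = refl
k4e-swap₂₃ (suc zero) zero (suc (suc zero)) = refl
k4e-swap₂₃ (suc zero) zero (suc (suc (suc zero))) = refl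
k4e-swap₂₃ (suc zero) (suc zero) zero = refl
k4e-swap₂₃ (suc zero) (suc zero) (suc zero) = refl
k4e-swap₂₃ (suc zero) (suc zero) (suc (suc zero)) = refl
k4e-swap₂₃ (suc zero) (suc zero) (suc (suc (suc zero))) = refl
k4e-swap₂₃ (suc zero) (suc (suc zero)) zero = refl
k4e-swap₂₃ (suc zero) (suc (suc zero)) (suc zero) = refl
k4e-swap₂₃ (suc zero) (suc (suc zero)) (suc (suc zero)) = refl
k4e-swap₂₃ (suc zero) (suc (suc zero)) (suc (suc (suc zero))) = refl
k4e-swap₂₃ (suc zero) (suc (suc (suc zero))) zero = refl
k4e-swap₂₃ (suc zero) (suc (suc (suc zero))) (suc zero) = refl
k4e-swap₂₃ (suc zero) (suc (suc (suc zero))) (suc (suc zero)) = refl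
k4e-swap₂₃ (suc zero) (suc (suc (suc zero))) (suc (suc (suc zero))) = refl
k4e-swap₂₃ (suc (suc zero)) zero zero = refl
k4e-swap₂₃ (suc (suc zero)) zero (suc zero) = refl
k4e-swap₂₃ (suc (suc zero)) zero (suc (suc zero)) = refl
k4e-swap₂₃ (suc (suc zero)) zero (suc (suc (suc zero))) = refl
k4e-swap₂₃ (suc (suc zero)) (suc zero) zero = refl
k4e-swap₂₃ (suc (suc zero)) (suc zero) (suc zero) = refl
k4e-swap₂₃ (suc (suc zero)) (suc zero) (suc (suc zero)) = refl
k4e-swap₂₃ (suc (suc zero)) (suc zero) (suc (suc (suc zero))) = refl
k4e-swap₂₃ (suc (suc zero)) (suc (suc zero)) zero = refl
k4e-swap₂₃ (suc (suc zero)) (suc (suc zero)) (suc zero) = refl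
k4e-swap₂₃ (suc (suc zero)) (suc (suc zero)) (suc (suc zero)) = refl
k4e-swap₂₃ (suc (suc zero)) (suc (suc zero)) (suc (suc (suc zero))) = refl
k4e-swap₂₃ (suc (suc zero)) (suc (suc (suc zero))) zero = refl
k4e-swap₂₃ (suc (suc zero)) (suc (suc (suc zero))) (suc zero) = refl
k4e-swap₂₃ (suc (suc zero)) (suc (suc (suc zero))) (suc (suc zero)) = refl
k4e-swap₂₃ (suc (suc zero)) (suc (suc (suc zero))) (suc (suc (suc zero))) = refl
k4e-swap₂₃ (suc (suc (suc zero))) zero zero = refl
k4e-swap₂₃ (suc (suc (suc zero))) zero (suc zero) = refl
k4e-swap₂₃ (suc (suc (suc zero))) zero (suc (suc zero)) = refl
k4e-swap₂₃ (suc (suc (suc zero))) zero (suc (suc (suc zero))) = refl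
k4e-swap₂₃ (suc (suc (suc zero))) (suc zero) zero = refl
k4e-swap₂₃ (suc (suc (suc zero))) (suc zero) (suc zero) = refl
k4e-swap₂₃ (suc (suc (suc zero))) (suc zero) (suc (suc zero)) = refl
k4e-swap₂₃ (suc (suc (suc zero))) (suc zero) (suc (suc (suc zero))) = refl
k4e-swap₂₃ (suc (suc (suc zero))) (suc (suc zero)) zero = refl
k4e-swap₂₃ (suc (suc (suc zero))) (suc (suc zero)) (suc zero) = refl
k4e-swap₂₃ (suc (suc (suc zero))) (suc (suc zero)) (suc (suc zero)) = refl
k4e-swap₂₃ (suc (suc (suc zero))) (suc (suc zero)) (suc (suc (suc zero))) = refl
k4e-swap₂₃ (suc (suc (suc zero))) (suc (suc (suc zero))) zero = refl
k4e-swap₂₃ (suc (suc (suc zero))) (suc (suc (suc zero))) (suc zero) = refl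
k4e-swap₂₃ (suc (suc (suc zero))) (suc (suc (suc zero))) (suc (suc zero)) = refl
k4e-swap₂₃ (suc (suc (suc zero))) (suc (suc (suc zero))) (suc (suc (suc zero))) = refl

k4e-loop : ∀ a c → k4e a a c ≡ false
k4e-loop zero zero = refl
k4e-loop zero (suc zero) = refl
k4e-loop zero (suc (suc zero)) = refl
k4e-loop zero (suc (suc (suc zero))) = refl
k4e-loop (suc zero) zero = refl
k4e-loop (suc zero) (suc zero) = refl
k4e-loop (suc zero) (suc (suc zero)) = refl
k4e-loop (suc zero) (suc (suc (suc zero))) = refl
k4e-loop (suc (suc zero)) zero = refl
k4e-loop (suc (suc zero)) (suc zero) = refl
k4e-loop (suc (suc zero)) (suc (suc zero)) = refl
k4e-loop (suc (suc zero)) (suc (suc (suc zero))) = refl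
k4e-loop (suc (suc (suc zero))) zero = refl
k4e-loop (suc (suc (suc zero))) (suc zero) = refl
k4e-loop (suc (suc (suc zero))) (suc (suc zero)) = refl
k4e-loop (suc (suc (suc zero))) (suc (suc (suc zero))) = refl

K4⁻ : 3Graph 4
K4⁻ = record { edge = k4e ; edge-swap₁₂ = k4e-swap₁₂ ; edge-swap₂₃ = k4e-swap₂₃ ; edge-loop = k4e-loop }

-- Upper bound.  Let δ₂(H) ≥ t with n < 3t.  Given a vertex v, pick u ≠ v
-- and an edge vuy.  The codegree sets of the pairs vu, vy, uy have total
-- size ≥ 3t > n, so some w lies in two of them; the two edges through w
-- and the edge vuy then span a K₄⁻ on {v, u, y, w}.
--
-- Lower bound.  For a triangle-free graph G on {1, …, n-1} the link
-- 3-graph on {0, …, n-1} has the edges {0,l,m} with lm ∈ G and the triples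
-- avoiding 0 spanning at most one edge of G.  Vertex 0 lies in no K₄⁻, and
-- its codegrees are controlled by the degrees of G.  Writing n = 3d + r,
-- we take for G the band graph (p ~ q iff d ≤ |p - q| < 2d) on 3d - 1
-- positions, which is d-regular and triangle-free, with position 0 blown up
-- into r + 1 copies.  For d ≥ 3 the degree estimates give minimum codegree
-- d; the two cases n = 7, 8 (d = 2) are checked by computation.

module Submission where

open import Defs
open import Data.Nat using (ℕ; zero; suc; _+_; _*_; _∸_; _≤_; _<_; _/_; _%_; z≤n; s≤s; _≤?_; _<?_; _≟_)
open import Data.Nat.Properties
open import Data.Nat.DivMod using (m≡m%n+[m/n]*n; m%n<n; /-mono-≤)
open import Data.Nat.ListAction using () renaming (sum to listSum)
open import Data.Nat.Tactic.RingSolver using (solve-∀)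
open import Algebra.Properties.CommutativeMonoid.Sum +-0-commutativeMonoid
  using (sum; ∑-distrib-+; sum-cong-≗)
open import Data.Fin using (Fin; zero; suc; toℕ)
import Data.Fin.Properties as Fin
open import Data.Fin.Properties using (toℕ<n; toℕ-injective)
open import Data.Bool using (Bool; true; false; if_then_else_; _∨_)
open import Data.Bool.Properties using (∧-zeroʳ)
open import Data.List using (map; tabulate)
open import Data.Product using (Σ; _×_; _,_; proj₁; proj₂; ∃-syntax)
open import Data.Sum using (_⊎_; inj₁; inj₂)
open import Data.Empty using (⊥; ⊥-elim)
open import Function using (_∘_; mk⇔)
open import Relation.Nullary using (¬_; yes; no; Dec; does; ¬?; _×-dec_; _⊎-dec_; _→-dec_)
open import Relation.Nullary.Decidable using (dec-true; dec-false; does-⇔; toWitness)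
open import Relation.Binary.PropositionalEquality

ind : Bool → ℕ
ind b = if b then 1 else 0

ind≤1 : ∀ b → ind b ≤ 1
ind≤1 true = ≤-refl
ind≤1 false = z≤n

ind-pos : ∀ {b} → 1 ≤ ind b → b ≡ true
ind-pos {true} _ = refl

ind-disjoint : ∀ {A B : Set} (a? : Dec A) (b? : Dec B) → ¬ (A × B) →
               ind (does a? ∨ does b?) ≡ ind (does a?) + ind (does b?)
ind-disjoint (yes a) (yes b) ¬ab = ⊥-elim (¬ab (a , b))
ind-disjoint (yes a) (no _) _ = refl
ind-disjoint (no _) _ _ = refl

witness : ∀ {A : Set} (a? : Dec A) → does a? ≡ true → A
witness (yes a) _ = a

refute : ∀ {A : Set} (a? : Dec A) → does a? ≡ false → ¬ A
refute (no ¬a) _ = ¬a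

listSum-tabulate : ∀ {A : Set} {n} (f : A → ℕ) (g : Fin n → A) → listSum (map f (tabulate g)) ≡ sum (f ∘ g)
listSum-tabulate {n = zero} f g = refl
listSum-tabulate {n = suc n} f g = cong (f (g zero) +_) (listSum-tabulate f (g ∘ suc))

codeg≡sum : ∀ {n} (H : 3Graph n) a b → codeg H a b ≡ sum (λ c → ind (edge H a b c))
codeg≡sum H a b = listSum-tabulate (λ c → ind (edge H a b c)) (λ c → c)

size : ∀ {n} → (Fin n → Bool) → ℕ
size A = sum (ind ∘ A)

element : ∀ {n} (A : Fin n → Bool) → 1 ≤ size A → ∃[ w ] A w ≡ true
element {suc n} A pos with A zero in eq
... | true = zero , eq
... | false with element (A ∘ suc) pos
...   | w , Aw = suc w , Aw

TwoOf : Bool → Bool → Bool → Set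
TwoOf a b c = (a ≡ true × b ≡ true) ⊎ (a ≡ true × c ≡ true) ⊎ (b ≡ true × c ≡ true)

twoOf? : ∀ a b c → TwoOf a b c ⊎ ind a + ind b + ind c ≤ 1
twoOf? true true c = inj₁ (inj₁ (refl , refl))
twoOf? true false true = inj₁ (inj₂ (inj₁ (refl , refl)))
twoOf? false true true = inj₁ (inj₂ (inj₂ (refl , refl)))
twoOf? true false false = inj₂ ≤-refl
twoOf? false true false = inj₂ ≤-refl
twoOf? false false c = inj₂ (ind≤1 c)

pigeonhole : ∀ {n} (A B C : Fin n → Bool) → n < size A + size B + size C →
             ∃[ w ] TwoOf (A w) (B w) (C w)
pigeonhole {suc n} A B C big with twoOf? (A zero) (B zero) (C zero)
... | inj₁ two = zero , two
... | inj₂ atMostOne with pigeonhole (A ∘ suc) (B ∘ suc) (C ∘ suc) (+-cancelˡ-< 1 _ _ (<-≤-trans big regroup))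
  where
  a b c : ℕ
  a = ind (A zero)
  b = ind (B zero)
  c = ind (C zero)
  regroup : a + size (A ∘ suc) + (b + size (B ∘ suc)) + (c + size (C ∘ suc))
            ≤ 1 + (size (A ∘ suc) + size (B ∘ suc) + size (C ∘ suc))
  regroup = ≤-trans (≤-reflexive (shuffle a b c _ _ _)) (+-monoˡ-≤ _ atMostOne)
    where
    shuffle : ∀ a b c x y z → a + x + (b + y) + (c + z) ≡ a + b + c + (x + y + z)
    shuffle = solve-∀
...   | w , two = suc w , two

module EdgeFacts {n} (H : 3Graph n) where
  swap₁₂ : ∀ {a b c} → edge H a b c ≡ true → edge H b a c ≡ true
  swap₁₂ {a} {b} {c} e = trans (sym (edge-swap₁₂ H a b c)) e

  swap₂₃ : ∀ {a b c} → edge H a b c ≡ true → edge H a c b ≡ true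
  swap₂₃ {a} {b} {c} e = trans (sym (edge-swap₂₃ H a b c)) e

  distinct₁₂ : ∀ {a b c} → edge H a b c ≡ true → ¬ a ≡ b
  distinct₁₂ {a} {c = c} e refl with trans (sym e) (edge-loop H a c)
  ... | ()

  distinct₁₃ : ∀ {a b c} → edge H a b c ≡ true → ¬ a ≡ c
  distinct₁₃ = distinct₁₂ ∘ swap₂₃

  distinct₂₃ : ∀ {a b c} → edge H a b c ≡ true → ¬ b ≡ c
  distinct₂₃ = distinct₁₂ ∘ swap₂₃ ∘ swap₁₂

k4⁻-copy : ∀ {n} (H : 3Graph n) {a b c e : Fin n} →
           edge H a b c ≡ true → edge H a b e ≡ true → edge H a c e ≡ true →
           Σ (Copy K4⁻ H) λ φ → proj₁ φ zero ≡ a × proj₁ φ (suc zero) ≡ b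
k4⁻-copy H {a} {b} {c} {e} abc abe ace = (φ , injective , edges) , refl , refl
  where
  open EdgeFacts H
  φ : Fin 4 → Fin _
  φ zero = a
  φ (suc zero) = b
  φ (suc (suc zero)) = c
  φ (suc (suc (suc zero))) = e

  a≢b : ¬ a ≡ b
  a≢b = distinct₁₂ abc
  a≢c : ¬ a ≡ c
  a≢c = distinct₁₃ abc
  b≢c : ¬ b ≡ c
  b≢c = distinct₂₃ abc
  a≢e : ¬ a ≡ e
  a≢e = distinct₁₃ abe
  b≢e : ¬ b ≡ e
  b≢e = distinct₂₃ abe
  c≢e : ¬ c ≡ e
  c≢e = distinct₂₃ ace

  injective : ∀ {x y} → φ x ≡ φ y → x ≡ y
  injective {zero} {zero} _ = refl
  injective {zero} {suc zero} p = ⊥-elim (a≢b p)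
  injective {zero} {suc (suc zero)} p = ⊥-elim (a≢c p)
  injective {zero} {suc (suc (suc zero))} p = ⊥-elim (a≢e p)
  injective {suc zero} {zero} p = ⊥-elim (a≢b (sym p))
  injective {suc zero} {suc zero} _ = refl
  injective {suc zero} {suc (suc zero)} p = ⊥-elim (b≢c p)
  injective {suc zero} {suc (suc (suc zero))} p = ⊥-elim (b≢e p)
  injective {suc (suc zero)} {zero} p = ⊥-elim (a≢c (sym p))
  injective {suc (suc zero)} {suc zero} p = ⊥-elim (b≢c (sym p))
  injective {suc (suc zero)} {suc (suc zero)} _ = refl
  injective {suc (suc zero)} {suc (suc (suc zero))} p = ⊥-elim (c≢e p)
  injective {suc (suc (suc zero))} {zero} p = ⊥-elim (a≢e (sym p))
  injective {suc (suc (suc zero))} {suc zero} p = ⊥-elim (b≢e (sym p))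
  injective {suc (suc (suc zero))} {suc (suc zero)} p = ⊥-elim (c≢e (sym p))
  injective {suc (suc (suc zero))} {suc (suc (suc zero))} _ = refl

  centred : ∀ y z → k4e zero y z ≡ true → edge H a (φ y) (φ z) ≡ true
  centred zero _ ()
  centred (suc _) zero ()
  centred (suc zero) (suc zero) ()
  centred (suc zero) (suc (suc zero)) _ = abc
  centred (suc zero) (suc (suc (suc zero))) _ = abe
  centred (suc (suc zero)) (suc zero) _ = swap₂₃ abc
  centred (suc (suc zero)) (suc (suc zero)) ()
  centred (suc (suc zero)) (suc (suc (suc zero))) _ = ace
  centred (suc (suc (suc zero))) (suc zero) _ = swap₂₃ abe
  centred (suc (suc (suc zero))) (suc (suc zero)) _ = swap₂₃ ace
  centred (suc (suc (suc zero))) (suc (suc (suc zero))) ()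

  -- every edge of K₄⁻ contains the centre 0
  edges : ∀ x y z → k4e x y z ≡ true → edge H (φ x) (φ y) (φ z) ≡ true
  edges zero y z k = centred y z k
  edges (suc x) zero z k = swap₁₂ (centred (suc x) z (trans (k4e-swap₁₂ zero (suc x) z) k))
  edges (suc x) (suc y) zero k =
    swap₂₃ (swap₁₂ (centred (suc x) (suc y)
      (trans (trans (k4e-swap₁₂ zero (suc x) (suc y)) (k4e-swap₂₃ (suc x) zero (suc y))) k)))
  edges (suc x) (suc y) (suc z) k with trans (sym k) (∧-zeroʳ (distinct3 (suc x) (suc y) (suc z)))
  ... | ()

covered-by-two : ∀ {n} (H : 3Graph n) {v u y w} → edge H v u y ≡ true →
                 TwoOf (edge H v u w) (edge H v y w) (edge H u y w) → InCopy K4⁻ H v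
covered-by-two H vuy (inj₁ (vuw , vyw)) with k4⁻-copy H vuy vuw vyw
... | φ , at0 , _ = φ , zero , at0
covered-by-two H vuy (inj₂ (inj₁ (vuw , uyw))) with k4⁻-copy H (swap₁₂ vuy) (swap₁₂ vuw) uyw
  where open EdgeFacts H
... | φ , _ , at1 = φ , suc zero , at1
covered-by-two H vuy (inj₂ (inj₂ (vyw , uyw)))
  with k4⁻-copy H (swap₁₂ (swap₂₃ vuy)) (swap₁₂ vyw) (swap₁₂ uyw)
  where open EdgeFacts H
... | φ , _ , at1 = φ , suc zero , at1

other : ∀ {m} (v : Fin (suc (suc m))) → ∃[ u ] ¬ v ≡ u
other zero = suc zero , λ ()
other (suc v) = zero , λ ()

-- Take v, some u ≠ v and an edge vuy.  The three
-- codegree sets of vu, vy, uy have total size ≥ 3t > n, so they overlap.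
dense⇒covering : ∀ {n} (H : 3Graph n) t → 2 ≤ n → n < 3 * t → MinCodegAtLeast H t → HasCovering K4⁻ H
dense⇒covering {suc zero} H t (s≤s ()) _ _ _
dense⇒covering {suc (suc m)} H t _ n<3t δ v =
  covered-by-two H vuy (proj₂ (pigeonhole (N v u) (N v y) (N u y) crowded))
  where
  open EdgeFacts H
  N : Fin (suc (suc m)) → Fin (suc (suc m)) → Fin (suc (suc m)) → Bool
  N a b = edge H a b
  codeg≥t : ∀ {a b} → ¬ a ≡ b → t ≤ size (N a b)
  codeg≥t {a} {b} a≢b = subst (t ≤_) (codeg≡sum H a b) (δ a b a≢b)
  u : Fin (suc (suc m))
  u = proj₁ (other v)
  v≢u : ¬ v ≡ u
  v≢u = proj₂ (other v)
  t≥1 : 1 ≤ t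
  t≥1 = n≢0⇒n>0 (λ { refl → <⇒≱ n<3t z≤n })
  edge-through-vu : ∃[ y ] N v u y ≡ true
  edge-through-vu = element (N v u) (≤-trans t≥1 (codeg≥t v≢u))
  y : Fin (suc (suc m))
  y = proj₁ edge-through-vu
  vuy : N v u y ≡ true
  vuy = proj₂ edge-through-vu
  crowded : suc (suc m) < size (N v u) + size (N v y) + size (N u y)
  crowded = <-≤-trans n<3t (≤-trans (≤-reflexive (three t))
    (+-mono-≤ (+-mono-≤ (codeg≥t v≢u) (codeg≥t (distinct₁₃ vuy))) (codeg≥t (distinct₂₃ vuy))))
    where
    three : ∀ t → 3 * t ≡ t + t + t
    three = solve-∀

sumBelow : (ℕ → ℕ) → ℕ → ℕ
sumBelow h m = sum {m} (h ∘ toℕ)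

sumBelow-cong : ∀ {f g} m → (∀ j → j < m → f j ≡ g j) → sumBelow f m ≡ sumBelow g m
sumBelow-cong m f≡g = sum-cong-≗ (λ i → f≡g (toℕ i) (toℕ<n i))

sumBelow-+ : ∀ f g m → sumBelow (λ j → f j + g j) m ≡ sumBelow f m + sumBelow g m
sumBelow-+ f g m = ∑-distrib-+ {m} (f ∘ toℕ) (g ∘ toℕ)

sumBelow-mono : ∀ f g m → (∀ j → j < m → f j ≤ g j) → sumBelow f m ≤ sumBelow g m
sumBelow-mono f g zero f≤g = z≤n
sumBelow-mono f g (suc m) f≤g =
  +-mono-≤ (f≤g 0 (s≤s z≤n)) (sumBelow-mono (f ∘ suc) (g ∘ suc) m (λ j j<m → f≤g (suc j) (s≤s j<m)))

sumBelow-const : ∀ h m c → (∀ j → j < m → h j ≡ c) → sumBelow h m ≡ m * c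
sumBelow-const h zero c h≡c = refl
sumBelow-const h (suc m) c h≡c =
  cong₂ _+_ (h≡c 0 (s≤s z≤n)) (sumBelow-const (h ∘ suc) m c (λ j j<m → h≡c (suc j) (s≤s j<m)))

sumBelow-zero : ∀ h m → (∀ j → j < m → h j ≡ 0) → sumBelow h m ≡ 0
sumBelow-zero h m h≡0 = trans (sumBelow-const h m 0 h≡0) (*-zeroʳ m)

sumBelow-split : ∀ h a b → sumBelow h (a + b) ≡ sumBelow h a + sumBelow (λ j → h (a + j)) b
sumBelow-split h zero b = refl
sumBelow-split h (suc a) b = trans (cong (h 0 +_) (sumBelow-split (h ∘ suc) a b)) (sym (+-assoc (h 0) _ _))

sumBelow-cover : ∀ h m → (∀ j → j < m → 1 ≤ h j) → m ≤ sumBelow h m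
sumBelow-cover h m 1≤h = begin
  m                       ≡⟨ *-identityʳ m ⟨
  m * 1                   ≡⟨ sumBelow-const (λ _ → 1) m 1 (λ _ _ → refl) ⟨
  sumBelow (λ _ → 1) m    ≤⟨ sumBelow-mono (λ _ → 1) h m 1≤h ⟩
  sumBelow h m            ∎
  where open ≤-Reasoning

sumBelow-window : ∀ h lo w t → (∀ j → j < lo → h j ≡ 0) → (∀ i → i < w → h (lo + i) ≡ 1) →
                  (∀ i → i < t → h (lo + w + i) ≡ 0) → sumBelow h (lo + w + t) ≡ w
sumBelow-window h lo w t below inside above = begin
  sumBelow h (lo + w + t)
    ≡⟨ sumBelow-split h (lo + w) t ⟩
  sumBelow h (lo + w) + sumBelow (λ i → h (lo + w + i)) t
    ≡⟨ cong₂ _+_ (sumBelow-split h lo w) (sumBelow-zero _ t above) ⟩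
  sumBelow h lo + sumBelow (λ i → h (lo + i)) w + 0
    ≡⟨ cong (λ x → x + sumBelow (λ i → h (lo + i)) w + 0) (sumBelow-zero h lo below) ⟩
  sumBelow (λ i → h (lo + i)) w + 0
    ≡⟨ +-identityʳ _ ⟩
  sumBelow (λ i → h (lo + i)) w
    ≡⟨ trans (sumBelow-const _ w 1 inside) (*-identityʳ w) ⟩
  w ∎
  where open ≡-Reasoning

sumBelow-singleton : ∀ m a → sumBelow (λ c → ind (does (c ≟ a))) m ≤ 1
sumBelow-singleton zero a = z≤n
sumBelow-singleton (suc m) zero = ≤-reflexive (cong suc (sumBelow-zero _ m (λ _ _ → refl)))
sumBelow-singleton (suc m) (suc a) = sumBelow-singleton m a

one-of-three : ∀ x y z → (y ≡ false → z ≡ false → x ≡ true) → 1 ≤ ind x + (ind y + ind z)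
one-of-three x true z _ = ≤-trans (s≤s z≤n) (m≤n+m _ (ind x))
one-of-three x false true _ = ≤-trans (s≤s z≤n) (m≤n+m _ (ind x))
one-of-three x false false h rewrite h refl refl = ≤-refl

one-of-five : ∀ x p q r s → (p ≡ false → q ≡ false → r ≡ false → s ≡ false → x ≡ true) →
              1 ≤ ind x + (ind p + ind q + ind r + ind s)
one-of-five x true q r s _ = ≤-trans (s≤s z≤n) (m≤n+m _ (ind x))
one-of-five x false true r s _ = ≤-trans (s≤s z≤n) (m≤n+m _ (ind x))
one-of-five x false false true s _ = ≤-trans (s≤s z≤n) (m≤n+m _ (ind x))
one-of-five x false false false true _ = ≤-trans (s≤s z≤n) (m≤n+m _ (ind x))
one-of-five x false false false false h rewrite h refl refl refl refl = ≤-refl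

-- Given a graph G on {1, 2, …} (a symmetric,
-- irreflexive relation on ℕ that never involves the apex 0), the 3-graph
-- on {0, …, n-1} has as edges the triples {0,l,m} with lm ∈ G, and the
-- triples {k,l,m} avoiding 0 that span at most one edge of G.
module Link (adj : ℕ → ℕ → Bool)
            (adj-sym : ∀ k l → adj k l ≡ adj l k)
            (adj-irrefl : ∀ k → adj k k ≡ false)
            (adj-apex : ∀ l → adj 0 l ≡ false) where

  pairs : ℕ → ℕ → ℕ → ℕ
  pairs k l m = ind (adj k l) + ind (adj k m) + ind (adj l m)

  ContainsApex : ℕ → ℕ → ℕ → Set
  ContainsApex k l m = k ≡ 0 ⊎ l ≡ 0 ⊎ m ≡ 0

  LinkEdge : ℕ → ℕ → ℕ → Set
  LinkEdge k l m = (¬ k ≡ l × ¬ l ≡ m × ¬ k ≡ m) × pairs k l m ≤ 1 × (ContainsApex k l m → 1 ≤ pairs k l m)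

  linkEdge? : ∀ k l m → Dec (LinkEdge k l m)
  linkEdge? k l m = (¬? (k ≟ l) ×-dec ¬? (l ≟ m) ×-dec ¬? (k ≟ m)) ×-dec (pairs k l m ≤? 1)
                    ×-dec (((k ≟ 0) ⊎-dec (l ≟ 0) ⊎-dec (m ≟ 0)) →-dec (1 ≤? pairs k l m))

  linkEdge : ℕ → ℕ → ℕ → Bool
  linkEdge k l m = does (linkEdge? k l m)

  pairs-swap₁₂ : ∀ k l m → pairs k l m ≡ pairs l k m
  pairs-swap₁₂ k l m rewrite adj-sym k l = +-swapʳ (ind (adj l k)) (ind (adj k m)) (ind (adj l m))
    where
    +-swapʳ : ∀ x y z → x + y + z ≡ x + z + y
    +-swapʳ = solve-∀

  pairs-swap₂₃ : ∀ k l m → pairs k l m ≡ pairs k m l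
  pairs-swap₂₃ k l m rewrite adj-sym l m = cong (_+ ind (adj m l)) (+-comm (ind (adj k l)) (ind (adj k m)))

  linkEdge-swap₁₂ : ∀ {k l m} → LinkEdge k l m → LinkEdge l k m
  linkEdge-swap₁₂ {k} {l} {m} ((k≢l , l≢m , k≢m) , sparse , covered) =
    (k≢l ∘ sym , k≢m , l≢m) , subst (_≤ 1) (pairs-swap₁₂ k l m) sparse ,
    λ apex → subst (1 ≤_) (pairs-swap₁₂ k l m) (covered (swap-apex apex))
    where
    swap-apex : ContainsApex l k m → ContainsApex k l m
    swap-apex (inj₁ l≡0) = inj₂ (inj₁ l≡0)
    swap-apex (inj₂ (inj₁ k≡0)) = inj₁ k≡0
    swap-apex (inj₂ (inj₂ m≡0)) = inj₂ (inj₂ m≡0)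

  linkEdge-swap₂₃ : ∀ {k l m} → LinkEdge k l m → LinkEdge k m l
  linkEdge-swap₂₃ {k} {l} {m} ((k≢l , l≢m , k≢m) , sparse , covered) =
    (k≢m , l≢m ∘ sym , k≢l) , subst (_≤ 1) (pairs-swap₂₃ k l m) sparse ,
    λ apex → subst (1 ≤_) (pairs-swap₂₃ k l m) (covered (swap-apex apex))
    where
    swap-apex : ContainsApex k m l → ContainsApex k l m
    swap-apex (inj₁ k≡0) = inj₁ k≡0
    swap-apex (inj₂ (inj₁ m≡0)) = inj₂ (inj₂ m≡0)
    swap-apex (inj₂ (inj₂ l≡0)) = inj₂ (inj₁ l≡0)

  linkGraph : (n : ℕ) → 3Graph n
  linkGraph n = record
    { edge = λ x y z → linkEdge (toℕ x) (toℕ y) (toℕ z)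
    ; edge-swap₁₂ = λ x y z → does-⇔ (mk⇔ linkEdge-swap₁₂ linkEdge-swap₁₂)
                                      (linkEdge? (toℕ x) (toℕ y) (toℕ z)) (linkEdge? (toℕ y) (toℕ x) (toℕ z))
    ; edge-swap₂₃ = λ x y z → does-⇔ (mk⇔ linkEdge-swap₂₃ linkEdge-swap₂₃)
                                      (linkEdge? (toℕ x) (toℕ y) (toℕ z)) (linkEdge? (toℕ x) (toℕ z) (toℕ y))
    ; edge-loop = λ x z → dec-false (linkEdge? (toℕ x) (toℕ x) (toℕ z)) (λ e → proj₁ (proj₁ e) refl)
    }

  adj-nonzero₁ : ∀ {k l} → adj k l ≡ true → ¬ k ≡ 0
  adj-nonzero₁ {l = l} kl refl with trans (sym kl) (adj-apex l)
  ... | ()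

  adj-nonzero₂ : ∀ {k l} → adj k l ≡ true → ¬ l ≡ 0
  adj-nonzero₂ {k} {l} kl = adj-nonzero₁ (trans (adj-sym l k) kl)

  adj-distinct : ∀ {k l} → adj k l ≡ true → ¬ k ≡ l
  adj-distinct {k} kl refl with trans (sym kl) (adj-irrefl k)
  ... | ()

  pairs-apex : ∀ l m → pairs 0 l m ≡ ind (adj l m)
  pairs-apex l m rewrite adj-apex l | adj-apex m = refl

  apex-link : ∀ {l m} → LinkEdge 0 l m → adj l m ≡ true
  apex-link {l} {m} (_ , _ , covered) = ind-pos (subst (1 ≤_) (pairs-apex l m) (covered (inj₁ refl)))

  no-cherry : ∀ {k l m} → LinkEdge k l m → adj k l ≡ true → adj k m ≡ true → ⊥
  no-cherry {k} {l} {m} (_ , sparse , _) kl km with ≤-trans two≤pairs sparse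
    where
    two≤pairs : 2 ≤ pairs k l m
    two≤pairs = ≤-trans (≤-reflexive (cong₂ (λ x y → ind x + ind y) (sym kl) (sym km))) (m≤m+n _ _)
  ... | s≤s ()

  TriangleFree : Set
  TriangleFree = ∀ {k l m} → adj k l ≡ true → adj k m ≡ true → adj l m ≡ true → ⊥

  -- If G is triangle-free, the apex lies in no copy of K₄⁻: as the centre
  -- of K₄⁻ it would give a triangle of G, as another vertex a cherry.
  apex-uncovered : TriangleFree → ∀ n → ¬ InCopy K4⁻ (linkGraph (suc n)) zero
  apex-uncovered triangle-free n ((φ , _ , edges) , x , φx≡apex) = at x φx≡apex
    where
    a : Fin 4 → ℕ
    a i = toℕ (φ i)
    e₀₁₂ : LinkEdge (a zero) (a (suc zero)) (a (suc (suc zero)))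
    e₀₁₂ = witness (linkEdge? _ _ _) (edges zero (suc zero) (suc (suc zero)) refl)
    e₀₁₃ : LinkEdge (a zero) (a (suc zero)) (a (suc (suc (suc zero))))
    e₀₁₃ = witness (linkEdge? _ _ _) (edges zero (suc zero) (suc (suc (suc zero))) refl)
    e₀₂₃ : LinkEdge (a zero) (a (suc (suc zero))) (a (suc (suc (suc zero))))
    e₀₂₃ = witness (linkEdge? _ _ _) (edges zero (suc (suc zero)) (suc (suc (suc zero))) refl)
    link₁ : ∀ {k l m} → k ≡ 0 → LinkEdge k l m → adj l m ≡ true
    link₁ refl = apex-link
    link₂ : ∀ {k l m} → l ≡ 0 → LinkEdge k l m → adj k m ≡ true
    link₂ l≡0 = link₁ l≡0 ∘ linkEdge-swap₁₂
    link₃ : ∀ {k l m} → m ≡ 0 → LinkEdge k l m → adj k l ≡ true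
    link₃ m≡0 = link₂ m≡0 ∘ linkEdge-swap₂₃
    at : ∀ i → φ i ≡ zero → ⊥
    at zero p =
      triangle-free (link₁ (cong toℕ p) e₀₁₂) (link₁ (cong toℕ p) e₀₁₃) (link₁ (cong toℕ p) e₀₂₃)
    at (suc zero) p = no-cherry e₀₂₃ (link₂ (cong toℕ p) e₀₁₂) (link₂ (cong toℕ p) e₀₁₃)
    at (suc (suc zero)) p = no-cherry e₀₁₃ (link₃ (cong toℕ p) e₀₁₂) (link₂ (cong toℕ p) e₀₂₃)
    at (suc (suc (suc zero))) p = no-cherry e₀₁₂ (link₃ (cong toℕ p) e₀₁₃) (link₃ (cong toℕ p) e₀₂₃)

  deg : ℕ → ℕ → ℕ
  deg n k = sumBelow (λ c → ind (adj k c)) n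

  codegBelow : ℕ → ℕ → ℕ → ℕ
  codegBelow n a b = sumBelow (λ c → ind (linkEdge a b c)) n

  apex-edge : ∀ {b c} → adj b c ≡ true → LinkEdge 0 b c
  apex-edge {b} {c} bc =
    (adj-nonzero₁ bc ∘ sym , adj-distinct bc , adj-nonzero₂ bc ∘ sym) , ≤-reflexive one , λ _ → ≤-reflexive (sym one)
    where
    one : pairs 0 b c ≡ 1
    one = trans (pairs-apex b c) (cong ind bc)

  edge-edge : ∀ {a b c} → adj a b ≡ true → adj a c ≡ false → adj b c ≡ false → LinkEdge a b c
  edge-edge {a} {b} {c} ab ac bc = (adj-distinct ab , b≢c , a≢c) , ≤-reflexive one , λ _ → ≤-reflexive (sym one)
    where
    one : pairs a b c ≡ 1
    one rewrite ab | ac | bc = refl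
    b≢c : ¬ b ≡ c
    b≢c refl with trans (sym ab) ac
    ... | ()
    a≢c : ¬ a ≡ c
    a≢c refl with trans (sym ab) (trans (adj-sym a b) bc)
    ... | ()

  nonedge-edge : ∀ {a b c} → ¬ a ≡ 0 → ¬ b ≡ 0 → ¬ c ≡ 0 → ¬ a ≡ b → ¬ c ≡ a → ¬ c ≡ b →
                 adj a b ≡ false → adj a c ≡ false → LinkEdge a b c
  nonedge-edge {a} {b} {c} a≢0 b≢0 c≢0 a≢b c≢a c≢b ab ac =
    (a≢b , c≢b ∘ sym , c≢a ∘ sym) , sparse , no-apex
    where
    sparse : pairs a b c ≤ 1
    sparse rewrite ab | ac = ind≤1 (adj b c)
    no-apex : ContainsApex a b c → 1 ≤ pairs a b c
    no-apex (inj₁ a≡0) = ⊥-elim (a≢0 a≡0)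
    no-apex (inj₂ (inj₁ b≡0)) = ⊥-elim (b≢0 b≡0)
    no-apex (inj₂ (inj₂ c≡0)) = ⊥-elim (c≢0 c≡0)

  codeg-apex : ∀ n b → deg n b ≤ codegBelow n 0 b
  codeg-apex n b = sumBelow-mono _ _ n λ c _ → ind-mono (dec-true (linkEdge? 0 b c) ∘ apex-edge)
    where
    ind-mono : ∀ {x y} → (x ≡ true → y ≡ true) → ind x ≤ ind y
    ind-mono {false} _ = z≤n
    ind-mono {true} x⇒y rewrite x⇒y refl = ≤-refl

  -- Codegree of an edge ab of G: every c is a G-neighbour of a or b, or
  -- completes abc to a link edge.
  codeg-edge : ∀ n {a b} → adj a b ≡ true → n ≤ codegBelow n a b + (deg n a + deg n b)
  codeg-edge n {a} {b} ab = begin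
    n
      ≤⟨ sumBelow-cover counted n (λ c _ → each-counted c) ⟩
    sumBelow counted n
      ≡⟨ sumBelow-+ (λ c → ind (linkEdge a b c)) (λ c → ind (adj a c) + ind (adj b c)) n ⟩
    codegBelow n a b + sumBelow (λ c → ind (adj a c) + ind (adj b c)) n
      ≡⟨ cong (codegBelow n a b +_) (sumBelow-+ (λ c → ind (adj a c)) (λ c → ind (adj b c)) n) ⟩
    codegBelow n a b + (deg n a + deg n b) ∎
    where
    open ≤-Reasoning
    counted : ℕ → ℕ
    counted c = ind (linkEdge a b c) + (ind (adj a c) + ind (adj b c))
    each-counted : ∀ c → 1 ≤ counted c
    each-counted c = one-of-three (linkEdge a b c) (adj a c) (adj b c)
                                  (λ ac bc → dec-true (linkEdge? a b c) (edge-edge ab ac bc))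

  -- Codegree of a non-edge ab of G avoiding 0: every c other than 0, a, b
  -- is a G-neighbour of a or completes abc to a link edge.
  codeg-nonedge : ∀ n {a b} → ¬ a ≡ 0 → ¬ b ≡ 0 → ¬ a ≡ b → adj a b ≡ false →
                  n ≤ codegBelow n a b + (3 + deg n a)
  codeg-nonedge n {a} {b} a≢0 b≢0 a≢b ab = begin
    n
      ≤⟨ sumBelow-cover counted n (λ c _ → each-counted c) ⟩
    sumBelow counted n
      ≡⟨ sumBelow-+ (λ c → ind (linkEdge a b c)) (λ c → excused c + ind (adj a c)) n ⟩
    codegBelow n a b + sumBelow (λ c → excused c + ind (adj a c)) n
      ≡⟨ cong (codegBelow n a b +_) (sumBelow-+ excused (λ c → ind (adj a c)) n) ⟩
    codegBelow n a b + (sumBelow excused n + deg n a)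
      ≤⟨ +-monoʳ-≤ (codegBelow n a b) (+-monoˡ-≤ (deg n a) excused≤3) ⟩
    codegBelow n a b + (3 + deg n a) ∎
    where
    open ≤-Reasoning
    is : ℕ → ℕ → ℕ
    is x c = ind (does (c ≟ x))
    excused : ℕ → ℕ
    excused c = is 0 c + is a c + is b c
    counted : ℕ → ℕ
    counted c = ind (linkEdge a b c) + (excused c + ind (adj a c))
    each-counted : ∀ c → 1 ≤ counted c
    each-counted c = one-of-five (linkEdge a b c) (does (c ≟ 0)) (does (c ≟ a)) (does (c ≟ b)) (adj a c)
      (λ c≢0 c≢a c≢b ac → dec-true (linkEdge? a b c)
        (nonedge-edge a≢0 b≢0 (refute (c ≟ 0) c≢0) a≢b (refute (c ≟ a) c≢a) (refute (c ≟ b) c≢b) ab ac))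
    excused≤3 : sumBelow excused n ≤ 3
    excused≤3 = begin
      sumBelow excused n
        ≡⟨ sumBelow-+ (λ c → is 0 c + is a c) (is b) n ⟩
      sumBelow (λ c → is 0 c + is a c) n + sumBelow (is b) n
        ≡⟨ cong (_+ sumBelow (is b) n) (sumBelow-+ (is 0) (is a) n) ⟩
      sumBelow (is 0) n + sumBelow (is a) n + sumBelow (is b) n
        ≤⟨ +-mono-≤ (+-mono-≤ (sumBelow-singleton n 0) (sumBelow-singleton n a)) (sumBelow-singleton n b) ⟩
      3 ∎

  link-min-codegree : ∀ n t →
    (∀ k → k < n → ¬ k ≡ 0 → t ≤ deg n k) →
    (∀ k l → k < n → l < n → adj k l ≡ true → t + (deg n k + deg n l) ≤ n) →
    (∀ k → k < n → ¬ k ≡ 0 → t + (3 + deg n k) ≤ n) →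
    MinCodegAtLeast (linkGraph n) t
  link-min-codegree n t deg≥t edge-room nonedge-room x y x≢y =
    subst (t ≤_) (sym (codeg≡sum (linkGraph n) x y))
          (pair (toℕ x) (toℕ y) (toℕ<n x) (toℕ<n y) (x≢y ∘ toℕ-injective))
    where
    codeg-sym : ∀ a b → codegBelow n a b ≡ codegBelow n b a
    codeg-sym a b = sumBelow-cong n λ c _ →
      cong ind (does-⇔ (mk⇔ linkEdge-swap₁₂ linkEdge-swap₁₂) (linkEdge? a b c) (linkEdge? b a c))
    pair : ∀ a b → a < n → b < n → ¬ a ≡ b → t ≤ codegBelow n a b
    pair zero zero _ _ a≢b = ⊥-elim (a≢b refl)
    pair zero (suc b) _ b<n _ = ≤-trans (deg≥t (suc b) b<n (λ ())) (codeg-apex n (suc b))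
    pair (suc a) zero a<n _ _ = subst (t ≤_) (codeg-sym zero (suc a)) (pair zero (suc a) (≤-trans (s≤s z≤n) a<n) a<n (λ ()))
    pair (suc a) (suc b) a<n b<n a≢b = by-adjacency (adj (suc a) (suc b)) refl
      where
      by-adjacency : ∀ v → adj (suc a) (suc b) ≡ v → t ≤ codegBelow n (suc a) (suc b)
      by-adjacency true ab =
        +-cancelʳ-≤ _ t _ (≤-trans (edge-room (suc a) (suc b) a<n b<n ab) (codeg-edge n ab))
      by-adjacency false ab =
        +-cancelʳ-≤ _ t _ (≤-trans (nonedge-room (suc a) a<n (λ ())) (codeg-nonedge n (λ ()) (λ ()) a≢b ab))

module BandGraph (e : ℕ) where
  d M : ℕ
  d = suc e
  M = d + d + e

  Near : ℕ → ℕ → Set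
  Near p q = p + d ≤ q × q < p + (d + d)

  near? : ∀ p q → Dec (Near p q)
  near? p q = (p + d ≤? q) ×-dec (q <? p + (d + d))

  Band : ℕ → ℕ → Set
  Band p q = Near p q ⊎ Near q p

  band? : ∀ p q → Dec (Band p q)
  band? p q = near? p q ⊎-dec near? q p

  band : ℕ → ℕ → Bool
  band p q = does (band? p q)

  band-irrefl : ∀ p → ¬ Band p p
  band-irrefl p (inj₁ (p+d≤p , _)) = <⇒≱ (m<m+n p (s≤s z≤n)) p+d≤p
  band-irrefl p (inj₂ (p+d≤p , _)) = <⇒≱ (m<m+n p (s≤s z≤n)) p+d≤p

  -- Three positions cannot be pairwise near: going right twice by at
  -- least d overshoots a window of width less than 2d, and going around
  -- a cycle is impossible.
  near-chain : ∀ {a b c} → Near a b → Near b c → Near a c → ⊥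
  near-chain {a} (a+d≤b , _) (b+d≤c , _) (_ , c<a+2d) =
    <⇒≱ c<a+2d (≤-trans (≤-reflexive (sym (+-assoc a d d))) (≤-trans (+-monoˡ-≤ d a+d≤b) b+d≤c))

  near-cycle : ∀ {a b c} → Near a b → Near b c → Near c a → ⊥
  near-cycle {a} (a+d≤b , _) (b+d≤c , _) (c+d≤a , _) =
    <⇒≱ (m<m+n a (s≤s z≤n))
        (≤-trans (≤-reflexive (reassoc a d)) (≤-trans (+-monoˡ-≤ d (≤-trans (+-monoˡ-≤ d a+d≤b) b+d≤c)) c+d≤a))
    where
    reassoc : ∀ a d → a + (d + d + d) ≡ a + d + d + d
    reassoc = solve-∀

  band-triangle-free : ∀ {p q s} → Band p q → Band p s → Band q s → ⊥
  band-triangle-free (inj₁ pq) (inj₁ ps) (inj₁ qs) = near-chain pq qs ps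
  band-triangle-free (inj₁ pq) (inj₁ ps) (inj₂ sq) = near-chain ps sq pq
  band-triangle-free (inj₁ pq) (inj₂ sp) (inj₁ qs) = near-cycle pq qs sp
  band-triangle-free (inj₁ pq) (inj₂ sp) (inj₂ sq) = near-chain sp pq sq
  band-triangle-free (inj₂ qp) (inj₁ ps) (inj₁ qs) = near-chain qp ps qs
  band-triangle-free (inj₂ qp) (inj₁ ps) (inj₂ sq) = near-cycle qp ps sq
  band-triangle-free (inj₂ qp) (inj₂ sp) (inj₁ qs) = near-chain qs sp qp
  band-triangle-free (inj₂ qp) (inj₂ sp) (inj₂ sq) = near-chain sq qp sp

  near-inside : ∀ p q → p + d ≤ q → q < p + (d + d) → ind (does (near? p q)) ≡ 1
  near-inside p q lo hi = cong ind (dec-true (near? p q) (lo , hi))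

  near-before : ∀ p q → q < p + d → ind (does (near? p q)) ≡ 0
  near-before p q q<p+d = cong ind (dec-false (near? p q) (λ (p+d≤q , _) → <⇒≱ q<p+d p+d≤q))

  near-after : ∀ p q → p + (d + d) ≤ q → ind (does (near? p q)) ≡ 0
  near-after p q p+2d≤q = cong ind (dec-false (near? p q) (λ (_ , q<p+2d) → <⇒≱ q<p+2d p+2d≤q))

  isRight isLeft : ℕ → ℕ → ℕ
  isRight p q = ind (does (near? p q))
  isLeft p q = ind (does (near? q p))

  right left : ℕ → ℕ
  right p = sumBelow (isRight p) M
  left p = sumBelow (isLeft p) M

  right-inside : ∀ p {i} → i < d → isRight p (p + d + i) ≡ 1
  right-inside p {i} i<d =
    near-inside p (p + d + i) (m≤m+n (p + d) i) (subst (_< p + (d + d)) (sym (+-assoc p d i)) (+-monoʳ-< p (+-monoʳ-< d i<d)))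

  -- the right window [p + d, p + 2d) of a position p < d lies inside [0, M)
  right-low : ∀ p t → e ≡ p + t → right p ≡ d
  right-low p t e≡p+t = trans (cong (sumBelow (isRight p)) M≡) (sumBelow-window (isRight p) (p + d) d t
      (λ q q<p+d → near-before p q q<p+d)
      (λ i i<d → right-inside p i<d)
      (λ i _ → near-after p (p + d + d + i) (≤-trans (≤-reflexive (sym (+-assoc p d d))) (m≤m+n (p + d + d) i))))
    where
    M≡ : M ≡ p + d + d + t
    M≡ = trans (cong (d + d +_) e≡p+t) (regroup d p t)
      where
      regroup : ∀ d p t → d + d + (p + t) ≡ p + d + d + t
      regroup = solve-∀

  left-low : ∀ p → p < d → left p ≡ 0
  left-low p p<d = sumBelow-zero (isLeft p) M (λ q _ → near-before q p (<-≤-trans p<d (m≤n+m d q)))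

  -- a position p = d + s in the middle third has its right window cut
  -- off by M after t = e - s points, and its left window contains [0, s]
  right-middle : ∀ s t → e ≡ s + t → right (d + s) ≡ t
  right-middle s t e≡s+t = trans (cong (sumBelow (isRight p)) M≡) (sumBelow-window (isRight p) (p + d) t 0
      (λ q q<p+d → near-before p q q<p+d)
      (λ i i<t → right-inside p (<-≤-trans i<t (≤-trans (subst (t ≤_) (sym e≡s+t) (m≤n+m t s)) (n≤1+n e))))
      (λ _ ()))
    where
    p : ℕ
    p = d + s
    M≡ : M ≡ p + d + t + 0
    M≡ = trans (cong (d + d +_) e≡s+t) (regroup d s t)
      where
      regroup : ∀ d s t → d + d + (s + t) ≡ d + s + d + t + 0
      regroup = solve-∀

  left-middle : ∀ s t → e ≡ s + t → left (d + s) ≡ suc s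
  left-middle s t e≡s+t = trans (cong (sumBelow (isLeft p)) M≡) (sumBelow-window (isLeft p) 0 (suc s) (d + e + t)
      (λ _ ())
      (λ i i<1+s → near-inside i p (subst (_≤ p) (+-comm d i) (+-monoʳ-≤ d (≤-pred i<1+s)))
                               (<-≤-trans (+-monoʳ-< d s<d) (m≤n+m (d + d) i)))
      (λ i _ → near-before (suc s + i) p (subst (p <_) (regroup d s i) (m≤m+n (suc p) i))))
    where
    p : ℕ
    p = d + s
    s<d : s < d
    s<d = s≤s (subst (s ≤_) (sym e≡s+t) (m≤m+n s t))
    M≡ : M ≡ 0 + suc s + (d + e + t)
    M≡ = trans (cong (λ x → suc x + suc x + x) e≡s+t)
               (trans (split-M s t) (cong (λ x → suc s + (suc x + x + t)) (sym e≡s+t)))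
      where
      split-M : ∀ s t → suc (s + t) + suc (s + t) + (s + t) ≡ suc s + (suc (s + t) + (s + t) + t)
      split-M = solve-∀
    regroup : ∀ d s i → suc (d + s) + i ≡ suc s + i + d
    regroup = solve-∀

  -- a position p = 2d + s in the last third has no right neighbours, and
  -- its left window (s, s + d] lies inside [0, M)
  right-high : ∀ s t → e ≡ suc s + t → right (d + d + s) ≡ 0
  right-high s t e≡1+s+t = sumBelow-zero (isRight p) M (λ q q<M → near-before p q (<-≤-trans q<M M≤p+d))
    where
    p : ℕ
    p = d + d + s
    M≤p+d : M ≤ p + d
    M≤p+d = ≤-trans (+-monoʳ-≤ (d + d) (≤-trans (n≤1+n e) (m≤n+m d s))) (≤-reflexive (sym (+-assoc (d + d) s d)))

  left-high : ∀ s t → e ≡ suc s + t → left (d + d + s) ≡ d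
  left-high s t e≡1+s+t = trans (cong (sumBelow (isLeft p)) M≡) (sumBelow-window (isLeft p) (suc s) d (d + t)
      (λ j j<1+s → near-after j p (subst (_≤ p) (+-comm (d + d) j) (+-monoʳ-≤ (d + d) (≤-pred j<1+s))))
      (λ i i<d → near-inside (suc s + i) p (subst₂ _≤_ (regroup₁ s i d) (regroup₂ s d) (+-monoˡ-≤ (s + d) i<d))
                             (subst (p <_) (regroup₃ d s i) (m≤m+n (suc p) i)))
      (λ i _ → near-before (suc s + d + i) p (subst (p <_) (regroup₄ d s i) (m≤m+n (suc p) i))))
    where
    p : ℕ
    p = d + d + s
    M≡ : M ≡ suc s + d + (d + t)
    M≡ = trans (cong (d + d +_) e≡1+s+t) (regroup d s t)
      where
      regroup : ∀ d s t → d + d + (suc s + t) ≡ suc s + d + (d + t)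
      regroup = solve-∀
    regroup₁ : ∀ s i d → suc i + (s + d) ≡ suc s + i + d
    regroup₁ = solve-∀
    regroup₂ : ∀ s d → d + (s + d) ≡ d + d + s
    regroup₂ = solve-∀
    regroup₃ : ∀ d s i → suc (d + d + s) + i ≡ suc s + i + (d + d)
    regroup₃ = solve-∀
    regroup₄ : ∀ d s i → suc (d + d + s) + i ≡ suc s + d + i + d
    regroup₄ = solve-∀

  near-asym : ∀ {p q} → ¬ (Near p q × Near q p)
  near-asym {p} ((p+d≤q , _) , (q+d≤p , _)) =
    <⇒≱ (m<m+n p (s≤s z≤n)) (≤-trans (+-monoˡ-≤ d (≤-trans (m≤m+n p d) p+d≤q)) q+d≤p)

  band-degree : ∀ p → p < M → sumBelow (λ q → ind (band p q)) M ≡ d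
  band-degree p p<M = begin
    sumBelow (λ q → ind (band p q)) M
      ≡⟨ sumBelow-cong {f = λ q → ind (band p q)} M (λ q _ → ind-disjoint (near? p q) (near? q p) near-asym) ⟩
    sumBelow (λ q → isRight p q + isLeft p q) M
      ≡⟨ sumBelow-+ (isRight p) (isLeft p) M ⟩
    right p + left p
      ≡⟨ by-third (p <? d) (p ∸ d <? d) ⟩
    d ∎
    where
    open ≡-Reasoning
    by-third : Dec (p < d) → Dec (p ∸ d < d) → right p + left p ≡ d
    by-third (yes p<d) _ =
      trans (cong₂ _+_ (right-low p (e ∸ p) (sym (m+[n∸m]≡n (≤-pred p<d)))) (left-low p p<d)) (+-identityʳ d)
    by-third (no p≮d) (yes s<d) = begin
      right p + left p
        ≡⟨ cong (λ x → right x + left x) p≡d+s ⟩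
      right (d + s) + left (d + s)
        ≡⟨ cong₂ _+_ (right-middle s (e ∸ s) e≡s+t) (left-middle s (e ∸ s) e≡s+t) ⟩
      e ∸ s + suc s
        ≡⟨ trans (+-suc (e ∸ s) s) (cong suc (trans (+-comm (e ∸ s) s) (sym e≡s+t))) ⟩
      d ∎
      where
      s : ℕ
      s = p ∸ d
      p≡d+s : p ≡ d + s
      p≡d+s = sym (m+[n∸m]≡n (≮⇒≥ p≮d))
      e≡s+t : e ≡ s + (e ∸ s)
      e≡s+t = sym (m+[n∸m]≡n (≤-pred s<d))
    by-third (no p≮d) (no s≮d) = begin
      right p + left p
        ≡⟨ cong (λ x → right x + left x) p≡2d+s ⟩
      right (d + d + s) + left (d + d + s)
        ≡⟨ cong₂ _+_ (right-high s (e ∸ suc s) e≡1+s+t) (left-high s (e ∸ suc s) e≡1+s+t) ⟩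
      d ∎
      where
      s : ℕ
      s = p ∸ d ∸ d
      p≡2d+s : p ≡ d + d + s
      p≡2d+s = trans (sym (m+[n∸m]≡n (≮⇒≥ p≮d)))
                     (trans (cong (d +_) (sym (m+[n∸m]≡n (≮⇒≥ s≮d)))) (sym (+-assoc d d s)))
      s<e : s < e
      s<e = +-cancelˡ-< (d + d) s e (subst (_< M) p≡2d+s p<M)
      e≡1+s+t : e ≡ suc s + (e ∸ suc s)
      e≡1+s+t = sym (m+[n∸m]≡n s<e)

-- The graph for the lower bound, on the vertices 1, …, n - 1 where
-- n = 3d + r is the order of the 3-graph: the band graph on the M = 3d - 1
-- positions, with position 0 blown up into r + 1 independent copies
-- (vertices 1, …, r + 1) and vertex r + 1 + j at position j ≥ 1.  Its link
-- 3-graph has no K₄⁻-covering and, for d ≥ 3, minimum codegree d.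
module Construction (e r : ℕ) where
  open BandGraph e public

  order : ℕ
  order = suc r + M

  position : ℕ → ℕ
  position k = k ∸ suc r

  Adj : ℕ → ℕ → Set
  Adj k l = ¬ k ≡ 0 × ¬ l ≡ 0 × Band (position k) (position l)

  adj? : ∀ k l → Dec (Adj k l)
  adj? k l = ¬? (k ≟ 0) ×-dec ¬? (l ≟ 0) ×-dec band? (position k) (position l)

  adj : ℕ → ℕ → Bool
  adj k l = does (adj? k l)

  adj-sym : ∀ k l → adj k l ≡ adj l k
  adj-sym k l = does-⇔ (mk⇔ swap swap) (adj? k l) (adj? l k)
    where
    swap : ∀ {k l} → Adj k l → Adj l k
    swap (k≢0 , l≢0 , inj₁ near) = l≢0 , k≢0 , inj₂ near
    swap (k≢0 , l≢0 , inj₂ near) = l≢0 , k≢0 , inj₁ near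

  adj-irrefl : ∀ k → adj k k ≡ false
  adj-irrefl k = dec-false (adj? k k) (λ (_ , _ , kk) → band-irrefl (position k) kk)

  adj-apex : ∀ l → adj 0 l ≡ false
  adj-apex l = dec-false (adj? 0 l) (λ (0≢0 , _) → 0≢0 refl)

  open Link adj adj-sym adj-irrefl adj-apex public

  adj⇒band : ∀ {k l} → adj k l ≡ true → Band (position k) (position l)
  adj⇒band {k} {l} kl = proj₂ (proj₂ (witness (adj? k l) kl))

  triangle-free : TriangleFree
  triangle-free {k} {l} {m} kl km lm =
    band-triangle-free (adj⇒band {k} {l} kl) (adj⇒band {k} {m} km) (adj⇒band {l} {m} lm)

  adj-positions : ∀ {k c} → ¬ k ≡ 0 → ¬ c ≡ 0 → adj k c ≡ band (position k) (position c)
  adj-positions {k} {c} k≢0 c≢0 =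
    does-⇔ (mk⇔ (proj₂ ∘ proj₂) (λ kc → k≢0 , c≢0 , kc)) (adj? k c) (band? (position k) (position c))

  -- A vertex k ≠ 0 has the d band-neighbours of its position, plus the r
  -- extra copies of position 0 if its position is adjacent to 0.
  degree : ∀ k → k < order → ¬ k ≡ 0 → deg order k ≡ r * ind (band (position k) 0) + d
  degree k k<order k≢0 = begin
    deg order k
      ≡⟨ sumBelow-split (λ c → ind (adj k c)) (suc r) M ⟩
    ind (adj k 0) + sumBelow (λ j → ind (adj k (suc j))) r + sumBelow (λ j → ind (adj k (suc r + j))) M
      ≡⟨ cong₂ _+_ (cong₂ _+_ (cong ind (trans (adj-sym k 0) (adj-apex k))) copies-of-0) other-positions ⟩
    r * ind (band (position k) 0) + d ∎
    where
    open ≡-Reasoning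
    copies-of-0 : sumBelow (λ j → ind (adj k (suc j))) r ≡ r * ind (band (position k) 0)
    copies-of-0 = sumBelow-const (λ j → ind (adj k (suc j))) r (ind (band (position k) 0)) λ j j<r →
      cong ind (trans (adj-positions {c = suc j} k≢0 (λ ())) (cong (band (position k)) (m≤n⇒m∸n≡0 (<⇒≤ j<r))))
    other-positions : sumBelow (λ j → ind (adj k (suc r + j))) M ≡ d
    other-positions = trans (sumBelow-cong {g = λ j → ind (band (position k) j)} M λ j _ →
        cong ind (trans (adj-positions {c = suc r + j} k≢0 (λ ())) (cong (band (position k)) (m+n∸m≡n (suc r) j))))
      (band-degree (position k) (m<n+o⇒m∸n<o k (suc r) k<order))

  degree-bounds : ∀ k → k < order → ¬ k ≡ 0 → d ≤ deg order k × deg order k ≤ r + d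
  degree-bounds k k<order k≢0 rewrite degree k k<order k≢0 =
    m≤n+m d _ , +-monoˡ-≤ d (≤-trans (*-monoʳ-≤ r (ind≤1 _)) (≤-reflexive (*-identityʳ r)))

  -- The endpoints of an edge are not both adjacent to position 0 (that
  -- would be a triangle), so their degrees add up to at most 2d + r.
  edge-room : ∀ k l → k < order → l < order → adj k l ≡ true → d + (deg order k + deg order l) ≤ order
  edge-room k l k<order l<order kl = begin
    d + (deg order k + deg order l)
      ≡⟨ cong (d +_) (cong₂ _+_ (degree k k<order (adj-nonzero₁ {k} {l} kl))
                                (degree l l<order (adj-nonzero₂ {k} {l} kl))) ⟩
    d + (r * x + d + (r * y + d))
      ≡⟨ regroup r x y d ⟩
    r * (x + y) + (d + d + d)
      ≤⟨ +-monoˡ-≤ (d + d + d) (≤-trans (*-monoʳ-≤ r x+y≤1) (≤-reflexive (*-identityʳ r))) ⟩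
    r + (d + d + d)
      ≡⟨ vertex-count r e ⟩
    order ∎
    where
    open ≤-Reasoning
    x y : ℕ
    x = ind (band (position k) 0)
    y = ind (band (position l) 0)
    x+y≤1 : x + y ≤ 1
    x+y≤1 with band (position k) 0 in k0 | band (position l) 0 in l0
    ... | true | true =
      ⊥-elim (band-triangle-free (adj⇒band {k} {l} kl) (witness (band? _ 0) k0) (witness (band? _ 0) l0))
    ... | true | false = ≤-refl
    ... | false | _ = ind≤1 _
    regroup : ∀ r x y d → d + (r * x + d + (r * y + d)) ≡ r * (x + y) + (d + d + d)
    regroup = solve-∀
    vertex-count : ∀ r e → r + (suc e + suc e + suc e) ≡ suc r + (suc e + suc e + e)
    vertex-count = solve-∀

  -- For d ≥ 3 a vertex has degree at most d + r ≤ n - d - 3.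
  nonedge-room : 3 ≤ d → ∀ k → k < order → ¬ k ≡ 0 → d + (3 + deg order k) ≤ order
  nonedge-room 3≤d k k<order k≢0 = begin
    d + (3 + deg order k)
      ≤⟨ +-monoʳ-≤ d (+-mono-≤ 3≤d (proj₂ (degree-bounds k k<order k≢0))) ⟩
    d + (d + (r + d))
      ≡⟨ vertex-count r e ⟩
    order ∎
    where
    open ≤-Reasoning
    vertex-count : ∀ r e → suc e + (suc e + (r + suc e)) ≡ suc r + (suc e + suc e + e)
    vertex-count = solve-∀

  bandLink : 3Graph order
  bandLink = linkGraph order

  bandLink-uncovered : ¬ HasCovering K4⁻ bandLink
  bandLink-uncovered covering = apex-uncovered (λ {k} {l} {m} → triangle-free {k} {l} {m}) (r + M) (covering zero)

  bandLink-codegree : 3 ≤ d → MinCodegAtLeast bandLink d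
  bandLink-codegree 3≤d = link-min-codegree order d (λ k k<order k≢0 → proj₁ (degree-bounds k k<order k≢0))
                                                  edge-room (nonedge-room 3≤d)

-- Minimum codegree is decidable, so small instances can be checked by computation.
minCodeg? : ∀ {n} (H : 3Graph n) t → Dec (MinCodegAtLeast H t)
minCodeg? H t = Fin.all? λ a → Fin.all? λ b → ¬? (a Fin.≟ b) →-dec (t ≤? codeg H a b)

Extremal : ℕ → ℕ → Set
Extremal n t = Σ (3Graph n) λ H → MinCodegAtLeast H t × ¬ HasCovering K4⁻ H

-- For n = 7, 8 (d = 2) the degree estimates are too weak; the codegrees are checked directly.
extremal-7 : Extremal 7 2
extremal-7 = bandLink , toWitness {a? = minCodeg? bandLink 2} _ , bandLink-uncovered
  where open Construction 1 1

extremal-8 : Extremal 8 2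
extremal-8 = bandLink , toWitness {a? = minCodeg? bandLink 2} _ , bandLink-uncovered
  where open Construction 1 2

extremal-large : ∀ n → 9 ≤ n → Extremal n (n / 3)
extremal-large n 9≤n = subst₂ Extremal order≡n d≡n/3 (bandLink , bandLink-codegree 3≤d , bandLink-uncovered)
  where
  open Construction (n / 3 ∸ 1) (n % 3)
  3≤n/3 : 3 ≤ n / 3
  3≤n/3 = /-mono-≤ {m = 9} {n = n} 9≤n (≤-refl {3})
  d≡n/3 : d ≡ n / 3
  d≡n/3 = m+[n∸m]≡n {1} (≤-trans (s≤s z≤n) 3≤n/3)
  3≤d : 3 ≤ d
  3≤d = subst (3 ≤_) (sym d≡n/3) 3≤n/3
  order≡n : order ≡ n
  order≡n = begin
    suc (n % 3) + (d + d + (n / 3 ∸ 1))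
      ≡⟨ regroup (n % 3) (n / 3 ∸ 1) ⟩
    n % 3 + d * 3
      ≡⟨ cong (λ q → n % 3 + q * 3) d≡n/3 ⟩
    n % 3 + n / 3 * 3
      ≡⟨ m≡m%n+[m/n]*n n 3 ⟨
    n ∎
    where
    open ≡-Reasoning
    regroup : ∀ r e → suc r + (suc e + suc e + e) ≡ r + suc e * 3
    regroup = solve-∀

lower-bound : ∀ n → 7 ≤ n → Extremal n (n / 3)
lower-bound n 7≤n = subst (λ k → Extremal k (k / 3)) (m+[n∸m]≡n 7≤n) (by-size (n ∸ 7))
  where
  by-size : ∀ m → Extremal (7 + m) ((7 + m) / 3)
  by-size 0 = extremal-7
  by-size 1 = extremal-8
  by-size (suc (suc m)) = extremal-large (9 + m) (m≤m+n 9 m)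

n<3[n/3+1] : ∀ n → n < 3 * suc (n / 3)
n<3[n/3+1] n = begin-strict
  n                   ≡⟨ m≡m%n+[m/n]*n n 3 ⟩
  n % 3 + n / 3 * 3   <⟨ +-monoˡ-< (n / 3 * 3) (m%n<n n 3) ⟩
  3 + n / 3 * 3       ≡⟨ regroup (n / 3) ⟩
  3 * suc (n / 3)     ∎
  where
  open ≤-Reasoning
  regroup : ∀ q → 3 + q * 3 ≡ 3 * suc q
  regroup = solve-∀

theorem3 : ∀ (n : ℕ) → 7 ≤ n → C2≡ n K4⁻ (n / 3)
theorem3 n 7≤n =
  lower-bound n 7≤n ,
  λ H δ≥n/3+1 → dense⇒covering H (suc (n / 3)) (≤-trans (s≤s (s≤s z≤n)) 7≤n) (n<3[n/3+1] n) δ≥n/3+1
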